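{- Let $\mathcal H=(\mathcal V,\mathcal E,w)$ be a weighted hypergraph with adjacency matrix $A$, and suppose $\mathcal H$ has a generalized $(m,k)$-hyperstar with vertex sets $\mathcal V_1,\mathcal V_2$, $|\mathcal V_1|=m\ge 1$. Then the algebraic multiplicity of $0$ as an eigenvalue of $A$ is at least $m-1$ (the degree of the generalized hyperstar).
   Context: A weighted hypergraph $\mathcal H=(\mathcal V,\mathcal E,w)$ has a finite vertex set $\mathcal V$ with $|\mathcal V|=N$, a finite family $\mathcal E$ of hyperedges (subsets of $\mathcal V$), and weights $w:\mathcal E\to(0,\infty)$. Its adjacency matrix is the $N\times N$ matrix $A$ with $A_{vv}=0$ and, for $u\neq v$, $A_{vu}=\sum_{e\in\mathcal E:\ \{u,v\}\subseteq e} w(e)$ (equivalently $A=H^{1/2}(H^T)^{1/2}-D_v$, where $H$ is the weighted incidence matrix with $H_{ve}=w(e)$ if $v\in e$ and $0$ otherwise, square roots are entrywise, and $D_v$ is the diagonal matrix of vertex degrees $d(v)=\sum_{e\ni v}w(e)$). A generalized $(m,k)$-hyperstar on $\mathcal H$ consists of disjoint subsets $\mathcal V_1,\mathcal V_2\subseteq\mathcal V$ with $|\mathcal V_1|=m$, $|\mathcal V_2|=k$, and, for each $v\in\mathcal V_1$, a family $P_v$ of subsets of $\mathcal V_2$ with $\bigcup_{\tilde e\in P_v}\tilde e=\mathcal V_2$, such that, writing $\bar{\mathcal E}:=\{\{v\}\cup\tilde e: v\in\mathcal V_1,\ \tilde e\in P_v\}$, we have $\bar{\mathcal E}\subseteq\mathcal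 E$ and: (i) for every $u\in\mathcal V_2$ the quantity $\sum_{\tilde e\in P_v,\ u\in\tilde e} w(\{v\}\cup\tilde e)$ is the same for all $v\in\mathcal V_1$; (ii) for every $v_1\in\mathcal V_1$ and every $v_2\in\mathcal V$ with $v_2\neq v_1$, no hyperedge $e\in\mathcal E\setminus\bar{\mathcal E}$ satisfies $\{v_1,v_2\}\subseteq e$. Its degree is $m-1$. -}

module Defs where

open import Level using (Level; _⊔_) renaming (suc to lsuc)
open import Data.Nat using (ℕ; zero; suc; _∸_)
open import Data.Fin using (Fin; zero; suc; toℕ; punchIn; _≟_)
open import Data.Fin.Subset using (Subset; _∈_; _∉_; ∣_∣)
open import Data.Bool using (Bool; true; false; if_then_else_; _∧_)
open import Data.Vec using (lookup)
open import Data.List using (List; foldr)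
import Data.List
open import Data.List.Relation.Unary.Unique.Propositional using (Unique)
import Data.List.Membership.Propositional as LMem
open import Data.Product using (Σ; ∃; _×_; _,_)
open import Relation.Nullary using (¬_; does)
open import Relation.Binary.PropositionalEquality using (_≡_; _≢_)
open import Algebra.Bundles using (CommutativeRing)
open import Algebra.Bundles.Raw using (RawRing)

module _ {c ℓ} (R : RawRing c ℓ) where
  open RawRing R

  ∑ : ∀ {n} → (Fin n → Carrier) → Carrier
  ∑ {zero}  f = 0#
  ∑ {suc n} f = f zero + ∑ (λ i → f (suc i))

  signed : ℕ → Carrier → Carrier
  signed zero    x = x
  signed (suc n) x = - signed n x

  det : ∀ n → (Fin n → Fin n → Carrier) → Carrier
  det zero    M = 1#
  det (suc n) M =
    ∑ (λ j → signed (toℕ j) (M zero j * det n (λ r s → M (suc r) (punchIn j s))))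

module _ {c ℓ} (R : CommutativeRing c ℓ) where
  open CommutativeRing R

  -- coefficient sequence: p n is the coefficient of X^n
  Poly : Set c
  Poly = ℕ → Carrier

  _≈ₚ_ : Poly → Poly → Set ℓ
  p ≈ₚ q = ∀ n → p n ≈ q n

  _+ₚ_ : Poly → Poly → Poly
  (p +ₚ q) n = p n + q n

  -ₚ_ : Poly → Poly
  (-ₚ p) n = - p n

  _*ₚ_ : Poly → Poly → Poly
  (p *ₚ q) n = ∑ rawRing (λ (i : Fin (suc n)) → p (toℕ i) * q (n ∸ toℕ i))

  constₚ : Carrier → Poly
  constₚ a zero    = a
  constₚ a (suc n) = 0#

  Xₚ : Poly
  Xₚ zero          = 0#
  Xₚ (suc zero)    = 1#
  Xₚ (suc (suc n)) = 0#

  polyRawRing : RawRing c ℓ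
  polyRawRing = record
    { Carrier = Poly ; _≈_ = _≈ₚ_ ; _+_ = _+ₚ_ ; _*_ = _*ₚ_ ; -_ = -ₚ_
    ; 0# = constₚ 0# ; 1# = constₚ 1# }

  _^ₚ_ : Poly → ℕ → Poly
  p ^ₚ zero  = constₚ 1#
  p ^ₚ suc n = p *ₚ (p ^ₚ n)

  charPoly : ∀ n → (Fin n → Fin n → Carrier) → Poly
  charPoly n A = det polyRawRing n
    (λ i j → (if does (i ≟ j) then Xₚ else constₚ 0#) +ₚ (-ₚ constₚ (A i j)))

  -- "0 is an eigenvalue of A of algebraic multiplicity at least r":
  -- X^r divides the (monic, hence nonzero) characteristic polynomial.
  ZeroAlgMultAtLeast : ∀ n → (Fin n → Fin n → Carrier) → ℕ → Set (c ⊔ ℓ)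
  ZeroAlgMultAtLeast n A r = Σ Poly λ q → charPoly n A ≈ₚ ((Xₚ ^ₚ r) *ₚ q)

  record Hypergraph (N : ℕ) : Set c where
    field
      M    : ℕ
      edge : Fin M → Subset N
      w    : Fin M → Carrier

  module _ {N : ℕ} (H : Hypergraph N) where
    open Hypergraph H

    adjacency : Fin N → Fin N → Carrier
    adjacency v u =
      if does (v ≟ u) then 0#
      else ∑ rawRing (λ e → if lookup (edge e) v ∧ lookup (edge e) u then w e else 0#)

    -- For v ∈ V₁ the family P_v is encoded by the
    -- duplicate-free list P v of (indices of) the hyperedges {v} ∪ ẽ, ẽ ∈ P_v;
    -- thus ẽ = edge i ∖ {v} and Ē = { edge i | v ∈ V₁ , i ∈ P v }.
    record Hyperstar (m k : ℕ) : Set (c ⊔ ℓ) where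
      field
        V₁ V₂    : Subset N
        disjoint : ∀ x → x ∈ V₁ → x ∉ V₂
        card₁    : ∣ V₁ ∣ ≡ m
        card₂    : ∣ V₂ ∣ ≡ k
        P        : Fin N → List (Fin M)
        P-unique : ∀ v → v ∈ V₁ → Unique (P v)
        P-contains : ∀ v → v ∈ V₁ → ∀ i → i LMem.∈ P v → v ∈ edge i
        P-sub      : ∀ v → v ∈ V₁ → ∀ i → i LMem.∈ P v →
                     ∀ u → u ∈ edge i → u ≢ v → u ∈ V₂
        P-cover    : ∀ v → v ∈ V₁ → ∀ u → u ∈ V₂ →
                     ∃ λ i → i LMem.∈ P v × u ∈ edge i
        balanced   : ∀ u → u ∈ V₂ → ∀ v v' → v ∈ V₁ → v' ∈ V₁ →
                     foldr _+_ 0# (Data.List.map (λ i → if lookup (edge i) u then w i else 0#) (P v))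
                     ≈ foldr _+_ 0# (Data.List.map (λ i → if lookup (edge i) u then w i else 0#) (P v'))
        isolated   : ∀ v₁ → v₁ ∈ V₁ → ∀ v₂ → v₂ ≢ v₁ → ∀ i →
                     ¬ (∃ λ v → v ∈ V₁ × i LMem.∈ P v) →
                     ¬ (v₁ ∈ edge i × v₂ ∈ edge i)

module Submission where

-- For v ∈ V₁ and u ∈ V₂ conditions (ii) and P_v ⊆ V₂ make A v u the weighted incidence sum
-- of u over P_v, and A v u = 0 for u ∉ V₂; by (i) all rows of A indexed by V₁ are therefore
-- one and the same row a, so the row of X·I − A at v ∈ V₁ is X·e_v − a. Expanding the
-- determinant multilinearly in these m rows, a term taking −a in two of them has two equal
-- rows and vanishes, so each surviving term carries X at least m − 1 times.

open import Algebra.Bundles using (CommutativeRing; Semiring)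
open import Algebra.Bundles.Raw using (RawRing)
open import Algebra.Structures using (IsAbelianGroup)
import Algebra.Construct.Pointwise as Pointwise
open import Data.Bool using (true; false; if_then_else_; _∧_)
open import Data.Empty using (⊥-elim)
open import Data.Fin using (Fin; zero; suc; toℕ; punchIn; _≟_)
open import Data.Fin.Properties using (0≢1+n; suc-injective)
open import Data.Fin.Subset using (Subset; _∈_; _∉_; ∣_∣)
open import Data.Fin.Subset.Properties using (_∈?_)
open import Data.List using (List; []; _∷_; length; foldr; map)
open import Data.List.Properties using (length-map)
open import Data.List.Membership.Propositional using () renaming (_∈_ to _∈ₗ_; _∉_ to _∉ₗ_)
open import Data.List.Membership.Propositional.Properties using (∈-map⁻)
open import Data.List.Relation.Unary.All using () renaming (lookup to All-lookup)
import Data.List.Relation.Unary.All as All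
import Data.List.Relation.Unary.All.Properties as All
open import Data.List.Relation.Unary.Any using (here; there)
open import Data.List.Relation.Unary.AllPairs using ([]; _∷_)
open import Data.List.Relation.Unary.Unique.Propositional using (Unique)
import Data.List.Relation.Unary.Unique.Propositional.Properties as Unique
open import Data.Nat using (ℕ; zero; suc; _∸_; _≤_)
open import Data.Product using (∃; _×_; _,_)
open import Data.Vec using ([]; _∷_; here; there; lookup)
open import Data.Vec.Properties using ([]=⇒lookup; lookup⇒[]=)
open import Data.Vec.Functional using (updateAt)
open import Data.Vec.Functional.Properties using (updateAt-updates; updateAt-minimal)
open import Function using (_∘_; const)
open import Relation.Binary.PropositionalEquality as ≡ using (_≡_; _≢_)
open import Relation.Nullary using (¬_; does; yes; no)
open import Relation.Nullary.Decidable using (dec-false)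

open import Defs hiding (_≈ₚ_; _+ₚ_; _*ₚ_; -ₚ_)

module FiniteSums {c ℓ} (R : CommutativeRing c ℓ) where
  open CommutativeRing R hiding (zero)
  open import Algebra.Properties.Ring ring using (-0#≈0#; -‿+-comm)
  open import Algebra.Properties.CommutativeSemigroup +-commutativeSemigroup
    using (interchange)
  open import Relation.Binary.Reasoning.Setoid setoid

  ∑ᵣ : ∀ {n} → (Fin n → Carrier) → Carrier
  ∑ᵣ = ∑ rawRing

  ∑-cong : ∀ {n} {f g : Fin n → Carrier} → (∀ i → f i ≈ g i) → ∑ᵣ f ≈ ∑ᵣ g
  ∑-cong {zero}  f≈g = refl
  ∑-cong {suc n} f≈g = +-cong (f≈g zero) (∑-cong (f≈g ∘ suc))

  ∑-zero : ∀ {n} {f : Fin n → Carrier} → (∀ i → f i ≈ 0#) → ∑ᵣ f ≈ 0#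
  ∑-zero {zero}  f≈0 = refl
  ∑-zero {suc n} f≈0 = trans (+-cong (f≈0 zero) (∑-zero (f≈0 ∘ suc))) (+-identityʳ 0#)

  ∑-distrib-+ : ∀ {n} (f g : Fin n → Carrier) → ∑ᵣ (λ i → f i + g i) ≈ ∑ᵣ f + ∑ᵣ g
  ∑-distrib-+ {zero}  f g = sym (+-identityʳ 0#)
  ∑-distrib-+ {suc n} f g =
    trans (+-congˡ (∑-distrib-+ (f ∘ suc) (g ∘ suc))) (interchange _ _ _ _)

  *-distribˡ-∑ : ∀ {n} x (f : Fin n → Carrier) → x * ∑ᵣ f ≈ ∑ᵣ (λ i → x * f i)
  *-distribˡ-∑ {zero}  x f = zeroʳ x
  *-distribˡ-∑ {suc n} x f = trans (distribˡ _ _ _) (+-congˡ (*-distribˡ-∑ x (f ∘ suc)))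

  -‿distrib-∑ : ∀ {n} (f : Fin n → Carrier) → - ∑ᵣ f ≈ ∑ᵣ (λ i → - f i)
  -‿distrib-∑ {zero}  f = -0#≈0#
  -‿distrib-∑ {suc n} f = trans (sym (-‿+-comm _ _)) (+-congˡ (-‿distrib-∑ (f ∘ suc)))

  ∑-if-≟ : ∀ {n} (p : Fin n) (h : Fin n → Carrier) →
           ∑ᵣ (λ e → if does (e ≟ p) then h e else 0#) ≈ h p
  ∑-if-≟ {suc n} zero    h = trans (+-congˡ (∑-zero {n} (λ _ → refl))) (+-identityʳ (h zero))
  ∑-if-≟ {suc n} (suc p) h = trans (+-congˡ (∑-if-≟ p (h ∘ suc))) (+-identityˡ (h (suc p)))

  ∑≈foldr : ∀ {n} (L : List (Fin n)) → Unique L → (f g : Fin n → Carrier) →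
    (∀ e → e ∈ₗ L → f e ≈ g e) → (∀ e → e ∉ₗ L → f e ≈ 0#) → ∑ᵣ f ≈ foldr _+_ 0# (map g L)
  ∑≈foldr []      _                f g _  off = ∑-zero (λ e → off e (λ ()))
  ∑≈foldr (p ∷ L) (p∉L ∷ unique-L) f g on off = begin
    ∑ᵣ f                                 ≈⟨ ∑-cong split ⟩
    ∑ᵣ (λ e → f-at-p e + f-off-p e)      ≈⟨ ∑-distrib-+ f-at-p f-off-p ⟩
    ∑ᵣ f-at-p + ∑ᵣ f-off-p               ≈⟨ +-cong (trans (∑-if-≟ p f) (on p (here ≡.refl)))
                                                     (∑≈foldr L unique-L f-off-p g on-L off-L) ⟩
    g p + foldr _+_ 0# (map g L)         ∎
    where
    f-at-p f-off-p : Fin _ → Carrier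
    f-at-p  e = if does (e ≟ p) then f e else 0#
    f-off-p e = if does (e ≟ p) then 0# else f e
    split : ∀ e → f e ≈ f-at-p e + f-off-p e
    split e with does (e ≟ p)
    ... | true  = sym (+-identityʳ (f e))
    ... | false = sym (+-identityˡ (f e))
    on-L : ∀ e → e ∈ₗ L → f-off-p e ≈ g e
    on-L e e∈L rewrite dec-false (e ≟ p) (All-lookup p∉L e∈L ∘ ≡.sym) = on e (there e∈L)
    off-L : ∀ e → e ∉ₗ L → f-off-p e ≈ 0#
    off-L e e∉L with e ≟ p
    ... | yes _   = refl
    ... | no  e≢p = off e λ { (here e≡p) → e≢p e≡p ; (there e∈L) → e∉L e∈L }

module Determinants {c ℓ} (R : CommutativeRing c ℓ) where
  open CommutativeRing R hiding (zero)
  open import Algebra.Properties.Ring ring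
    using (-‿involutive; -0#≈0#; -‿+-comm; -‿distribʳ-*; +-inverseʳ-unique)
  open import Algebra.Properties.CommutativeSemigroup *-commutativeSemigroup
    using (x∙yz≈y∙xz)
  open FiniteSums R
  open import Relation.Binary.Reasoning.Setoid setoid

  sgn : ℕ → Carrier → Carrier
  sgn = signed rawRing

  sgn-cong : ∀ k {x y} → x ≈ y → sgn k x ≈ sgn k y
  sgn-cong zero    x≈y = x≈y
  sgn-cong (suc k) x≈y = -‿cong (sgn-cong k x≈y)

  sgn-distrib-+ : ∀ k x y → sgn k (x + y) ≈ sgn k x + sgn k y
  sgn-distrib-+ zero    x y = refl
  sgn-distrib-+ (suc k) x y = trans (-‿cong (sgn-distrib-+ k x y)) (sym (-‿+-comm _ _))

  sgn-*ˡ : ∀ k x y → sgn k (x * y) ≈ x * sgn k y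
  sgn-*ˡ zero    x y = refl
  sgn-*ˡ (suc k) x y = trans (-‿cong (sgn-*ˡ k x y)) (-‿distribʳ-* _ _)

  sgn-zero : ∀ k → sgn k 0# ≈ 0#
  sgn-zero zero    = refl
  sgn-zero (suc k) = trans (-‿cong (sgn-zero k)) -0#≈0#

  sgn-neg : ∀ k x → sgn k (- x) ≈ - sgn k x
  sgn-neg zero    x = refl
  sgn-neg (suc k) x = -‿cong (sgn-neg k x)

  alternatingSum : ∀ {n} → (Fin n → Carrier) → Carrier
  alternatingSum t = ∑ᵣ (λ j → sgn (toℕ j) (t j))

  alternatingSum-cong : ∀ {n} {t u : Fin n → Carrier} →
                        (∀ j → t j ≈ u j) → alternatingSum t ≈ alternatingSum u
  alternatingSum-cong t≈u = ∑-cong (λ j → sgn-cong (toℕ j) (t≈u j))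

  alternatingSum-distrib-+ : ∀ {n} (t u : Fin n → Carrier) →
    alternatingSum (λ j → t j + u j) ≈ alternatingSum t + alternatingSum u
  alternatingSum-distrib-+ t u =
    trans (∑-cong (λ j → sgn-distrib-+ (toℕ j) (t j) (u j)))
          (∑-distrib-+ (λ j → sgn (toℕ j) (t j)) (λ j → sgn (toℕ j) (u j)))

  *-distribˡ-alternatingSum : ∀ {n} x (t : Fin n → Carrier) →
    x * alternatingSum t ≈ alternatingSum (λ j → x * t j)
  *-distribˡ-alternatingSum x t =
    trans (*-distribˡ-∑ x (λ j → sgn (toℕ j) (t j))) (∑-cong (λ j → sym (sgn-*ˡ (toℕ j) x (t j))))

  alternatingSum-suc : ∀ {n} (t : Fin (suc n) → Carrier) →
    alternatingSum t ≈ t zero - alternatingSum (t ∘ suc)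
  alternatingSum-suc t = +-congˡ (sym (-‿distrib-∑ (λ j → sgn (toℕ j) (t (suc j)))))

  alternatingSum-linear : ∀ {n} x {t u v : Fin n → Carrier} → (∀ j → t j ≈ x * u j + v j) →
    alternatingSum t ≈ x * alternatingSum u + alternatingSum v
  alternatingSum-linear x {t} {u} {v} t≈xu+v = begin
    alternatingSum t                                   ≈⟨ alternatingSum-cong t≈xu+v ⟩
    alternatingSum (λ j → x * u j + v j)               ≈⟨ alternatingSum-distrib-+ _ v ⟩
    alternatingSum (λ j → x * u j) + alternatingSum v  ≈⟨ +-congʳ (*-distribˡ-alternatingSum x u) ⟨
    x * alternatingSum u + alternatingSum v            ∎

  Matrix : ℕ → Set c
  Matrix n = Fin n → Fin n → Carrier

  Det : ∀ n → Matrix n → Carrier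
  Det = det rawRing

  minor : ∀ {n} → Matrix (suc n) → Fin (suc n) → Matrix n
  minor M j r s = M (suc r) (punchIn j s)

  det-cong : ∀ n {M N : Matrix n} → (∀ i j → M i j ≈ N i j) → Det n M ≈ Det n N
  det-cong zero    M≈N = refl
  det-cong (suc n) M≈N = alternatingSum-cong (λ j →
    *-cong (M≈N zero j) (det-cong n (λ r s → M≈N (suc r) (punchIn j s))))

  AgreeOffRow : ∀ {n} → Fin n → Matrix n → Matrix n → Set ℓ
  AgreeOffRow r M N = ∀ i → i ≢ r → ∀ s → M i s ≈ N i s

  det-linear-row : ∀ n (r : Fin n) x (M M₁ M₂ : Matrix n) →
    AgreeOffRow r M M₁ → AgreeOffRow r M M₂ → (∀ s → M r s ≈ x * M₁ r s + M₂ r s) →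
    Det n M ≈ x * Det n M₁ + Det n M₂
  det-linear-row (suc n) zero x M M₁ M₂ M≈M₁ M≈M₂ row = alternatingSum-linear x (λ j → begin
    M zero j * Det n (minor M j)                                     ≈⟨ *-congʳ (row j) ⟩
    (x * M₁ zero j + M₂ zero j) * Det n (minor M j)                  ≈⟨ distribʳ _ _ _ ⟩
    x * M₁ zero j * Det n (minor M j) + M₂ zero j * Det n (minor M j)
      ≈⟨ +-cong (trans (*-assoc _ _ _) (*-congˡ (*-congˡ (minor≈ M≈M₁ j))))
                (*-congˡ (minor≈ M≈M₂ j)) ⟩
    x * (M₁ zero j * Det n (minor M₁ j)) + M₂ zero j * Det n (minor M₂ j) ∎)
    where
    minor≈ : ∀ {N} → AgreeOffRow zero M N → ∀ j → Det n (minor M j) ≈ Det n (minor N j)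
    minor≈ M≈N j = det-cong n (λ r s → M≈N (suc r) (λ ()) (punchIn j s))
  det-linear-row (suc n) (suc r) x M M₁ M₂ M≈M₁ M≈M₂ row = alternatingSum-linear x (λ j → begin
    M zero j * Det n (minor M j)
      ≈⟨ *-congˡ (det-linear-row n r x (minor M j) (minor M₁ j) (minor M₂ j)
                    (minors-agree M≈M₁ j) (minors-agree M≈M₂ j) (row ∘ punchIn j)) ⟩
    M zero j * (x * Det n (minor M₁ j) + Det n (minor M₂ j))
      ≈⟨ distribˡ _ _ _ ⟩
    M zero j * (x * Det n (minor M₁ j)) + M zero j * Det n (minor M₂ j)
      ≈⟨ +-cong (trans (x∙yz≈y∙xz _ _ _) (*-congˡ (*-congʳ (M≈M₁ zero 0≢1+n j))))
                (*-congʳ (M≈M₂ zero 0≢1+n j)) ⟩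
    x * (M₁ zero j * Det n (minor M₁ j)) + M₂ zero j * Det n (minor M₂ j) ∎)
    where
    minors-agree : ∀ {N} → AgreeOffRow (suc r) M N → ∀ j → AgreeOffRow r (minor M j) (minor N j)
    minors-agree M≈N j i i≢r s = M≈N (suc i) (i≢r ∘ suc-injective) (punchIn j s)

  det≈0-if-minors≈0 : ∀ n (M : Matrix (suc n)) → (∀ j → Det n (minor M j) ≈ 0#) →
                      Det (suc n) M ≈ 0#
  det≈0-if-minors≈0 n M minors≈0 =
    ∑-zero (λ j → trans (sgn-cong (toℕ j) (trans (*-congˡ (minors≈0 j)) (zeroʳ (M zero j))))
                        (sgn-zero (toℕ j)))

  -- The columns other than p and q in increasing order; the value for p ≡ q is irrelevant.
  punchIn₂ : ∀ {n} → Fin (suc (suc n)) → Fin (suc (suc n)) → Fin n → Fin (suc (suc n))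
  punchIn₂ zero    zero    s = suc (suc s)
  punchIn₂ zero    (suc q) s = suc (punchIn q s)
  punchIn₂ (suc p) zero    s = suc (punchIn p s)
  punchIn₂ {suc n} (suc p) (suc q) zero    = zero
  punchIn₂ {suc n} (suc p) (suc q) (suc s) = suc (punchIn₂ p q s)

  punchIn₂-comm : ∀ {n} (p q : Fin (suc (suc n))) s → punchIn₂ p q s ≡ punchIn₂ q p s
  punchIn₂-comm zero    zero    s = ≡.refl
  punchIn₂-comm zero    (suc q) s = ≡.refl
  punchIn₂-comm (suc p) zero    s = ≡.refl
  punchIn₂-comm {suc n} (suc p) (suc q) zero    = ≡.refl
  punchIn₂-comm {suc n} (suc p) (suc q) (suc s) = ≡.cong suc (punchIn₂-comm p q s)

  punchIn-punchIn : ∀ {n} (j : Fin (suc (suc n))) l s →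
                    punchIn j (punchIn l s) ≡ punchIn₂ j (punchIn j l) s
  punchIn-punchIn zero    l       s = ≡.refl
  punchIn-punchIn (suc j) zero    s = ≡.refl
  punchIn-punchIn {suc n} (suc j) (suc l) zero    = ≡.refl
  punchIn-punchIn {suc n} (suc j) (suc l) (suc s) = ≡.cong suc (punchIn-punchIn j l s)

  minor₂ : ∀ {n} → Matrix (suc (suc n)) → Fin (suc (suc n)) → Fin (suc (suc n)) → Matrix n
  minor₂ M p q r s = M (suc (suc r)) (punchIn₂ p q s)

  det-minor₂-comm : ∀ {n} (M : Matrix (suc (suc n))) p q →
                    Det n (minor₂ M p q) ≈ Det n (minor₂ M q p)
  det-minor₂-comm {n} M p q =
    det-cong n (λ r s → reflexive (≡.cong (M (suc (suc r))) (punchIn₂-comm p q s)))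

  alternatingSum² : ∀ {m n} → (Fin m → Fin n → Carrier) → Carrier
  alternatingSum² F = alternatingSum (λ j → alternatingSum (F j))

  alternatingSum²-cong : ∀ {m n} {F G : Fin m → Fin n → Carrier} →
    (∀ j l → F j l ≈ G j l) → alternatingSum² F ≈ alternatingSum² G
  alternatingSum²-cong F≈G = alternatingSum-cong (λ j → alternatingSum-cong (F≈G j))

  alternatingSum²-distrib-+ : ∀ {m n} (F G : Fin m → Fin n → Carrier) →
    alternatingSum² (λ j l → F j l + G j l) ≈ alternatingSum² F + alternatingSum² G
  alternatingSum²-distrib-+ F G =
    trans (alternatingSum-cong (λ j → alternatingSum-distrib-+ (F j) (G j)))
          (alternatingSum-distrib-+ (λ j → alternatingSum (F j)) (λ j → alternatingSum (G j)))

  twoRowTerm : ∀ {n} → Matrix (suc (suc n)) → Fin (suc (suc n)) → Fin (suc n) → Carrier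
  twoRowTerm {n} M j l = M zero j * (M (suc zero) (punchIn j l) * Det n (minor₂ M j (punchIn j l)))

  det-expand-twice : ∀ n (M : Matrix (suc (suc n))) →
                     Det (suc (suc n)) M ≈ alternatingSum² (twoRowTerm M)
  det-expand-twice n M = alternatingSum-cong (λ j → begin
    M zero j * alternatingSum (t j)           ≈⟨ *-distribˡ-alternatingSum (M zero j) (t j) ⟩
    alternatingSum (λ l → M zero j * t j l)
      ≈⟨ alternatingSum-cong (λ l → *-congˡ {M zero j} (*-congˡ {M (suc zero) (punchIn j l)}
           (det-cong n (λ r s → reflexive (≡.cong (M (suc (suc r))) (punchIn-punchIn j l s)))))) ⟩
    alternatingSum (twoRowTerm M j)           ∎)
    where
    t : Fin (suc (suc n)) → Fin (suc n) → Carrier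
    t j l = M (suc zero) (punchIn j l) * Det n (minor (minor M j) l)

  alternatingSum-distrib-- : ∀ {n} (t u : Fin n → Carrier) →
    alternatingSum (λ j → t j - u j) ≈ alternatingSum t - alternatingSum u
  alternatingSum-distrib-- t u = begin
    alternatingSum (λ j → t j - u j)
      ≈⟨ alternatingSum-distrib-+ t (λ j → - u j) ⟩
    alternatingSum t + alternatingSum (λ j → - u j)
      ≈⟨ +-congˡ (∑-cong (λ j → sgn-neg (toℕ j) (u j))) ⟩
    alternatingSum t + ∑ᵣ (λ j → - sgn (toℕ j) (u j))
      ≈⟨ +-congˡ (-‿distrib-∑ (λ j → sgn (toℕ j) (u j))) ⟨
    alternatingSum t - alternatingSum u
      ∎

  -- The terms of the ordered pairs (p, q) and (q, p) of distinct indices have opposite signs.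
  alternatingSum²-offDiagonal≈0 : ∀ n (G : Fin (suc n) → Fin (suc n) → Carrier) →
    (∀ p q → G p q ≈ G q p) → alternatingSum² (λ j l → G j (punchIn j l)) ≈ 0#
  alternatingSum²-offDiagonal≈0 zero    G G-sym = +-identityʳ 0#
  alternatingSum²-offDiagonal≈0 (suc n) G G-sym = begin
    alternatingSum² (λ j l → G j (punchIn j l))
      ≈⟨ alternatingSum-suc (λ j → alternatingSum (λ l → G j (punchIn j l))) ⟩
    a - alternatingSum (λ j → alternatingSum (λ l → G (suc j) (punchIn (suc j) l)))
      ≈⟨ +-congˡ (-‿cong (alternatingSum-cong (λ j →
           alternatingSum-suc (λ l → G (suc j) (punchIn (suc j) l))))) ⟩
    a - alternatingSum (λ j → b j - alternatingSum (λ l → G′ j (punchIn j l)))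
      ≈⟨ +-congˡ (-‿cong (alternatingSum-distrib-- b
           (λ j → alternatingSum (λ l → G′ j (punchIn j l))))) ⟩
    a - (alternatingSum b - alternatingSum² (λ j l → G′ j (punchIn j l)))
      ≈⟨ +-congˡ (-‿cong (+-cong (alternatingSum-cong (λ j → G-sym (suc j) zero))
           (-‿cong (alternatingSum²-offDiagonal≈0 n G′ (λ p q → G-sym (suc p) (suc q)))))) ⟩
    a - (a - 0#)
      ≈⟨ +-congˡ (-‿cong (trans (+-congˡ -0#≈0#) (+-identityʳ a))) ⟩
    a - a
      ≈⟨ -‿inverseʳ a ⟩
    0# ∎
    where
    G′ : Fin (suc n) → Fin (suc n) → Carrier
    G′ p q = G (suc p) (suc q)
    a = alternatingSum (λ l → G zero (suc l))
    b = λ j → G (suc j) zero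

  det-equal-rows01 : ∀ n (M : Matrix (suc (suc n))) → (∀ s → M zero s ≈ M (suc zero) s) →
                     Det (suc (suc n)) M ≈ 0#
  det-equal-rows01 n M row0≈row1 = begin
    Det (suc (suc n)) M
      ≈⟨ det-expand-twice n M ⟩
    alternatingSum² (twoRowTerm M)
      ≈⟨ alternatingSum²-cong (λ j l → *-congˡ {M zero j}
           (*-congʳ {Det n (minor₂ M j (punchIn j l))} (sym (row0≈row1 (punchIn j l))))) ⟩
    alternatingSum² (λ j l → G j (punchIn j l))
      ≈⟨ alternatingSum²-offDiagonal≈0 (suc n) G G-sym ⟩
    0# ∎
    where
    G : Fin (suc (suc n)) → Fin (suc (suc n)) → Carrier
    G p q = M zero p * (M zero q * Det n (minor₂ M p q))
    G-sym : ∀ p q → G p q ≈ G q p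
    G-sym p q = trans (x∙yz≈y∙xz _ _ _) (*-congˡ (*-congˡ (det-minor₂-comm M p q)))

  swapRows01 : ∀ {n} → Matrix (suc (suc n)) → Matrix (suc (suc n))
  swapRows01 M zero          = M (suc zero)
  swapRows01 M (suc zero)    = M zero
  swapRows01 M (suc (suc r)) = M (suc (suc r))

  det-swapRows01 : ∀ n (M : Matrix (suc (suc n))) →
                   Det (suc (suc n)) (swapRows01 M) ≈ - Det (suc (suc n)) M
  det-swapRows01 n M = +-inverseʳ-unique _ _ (begin
    Det (suc (suc n)) M + Det (suc (suc n)) (swapRows01 M)
      ≈⟨ +-cong (det-expand-twice n M) (det-expand-twice n (swapRows01 M)) ⟩
    alternatingSum² (twoRowTerm M) + alternatingSum² (twoRowTerm (swapRows01 M))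
      ≈⟨ alternatingSum²-distrib-+ (twoRowTerm M) (twoRowTerm (swapRows01 M)) ⟨
    alternatingSum² (λ j l → G j (punchIn j l))
      ≈⟨ alternatingSum²-offDiagonal≈0 (suc n) G G-sym ⟩
    0# ∎)
    where
    G : Fin (suc (suc n)) → Fin (suc (suc n)) → Carrier
    G p q = M zero p * (M (suc zero) q * Det n (minor₂ M p q))
          + M (suc zero) p * (M zero q * Det n (minor₂ M p q))
    G-sym : ∀ p q → G p q ≈ G q p
    G-sym p q =
      trans (+-cong (swap-factors zero (suc zero)) (swap-factors (suc zero) zero)) (+-comm _ _)
      where
      swap-factors : ∀ a b → M a p * (M b q * Det n (minor₂ M p q))
                           ≈ M b q * (M a p * Det n (minor₂ M q p))
      swap-factors a b = trans (x∙yz≈y∙xz _ _ _) (*-congˡ (*-congˡ (det-minor₂-comm M p q)))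

  -- Swapping rows 0 and 1 moves the repeated row out of row 0, so that the minors
  -- along row 0 each have two equal rows.
  det-equal-row0 : ∀ n (M : Matrix (suc n)) q → (∀ s → M zero s ≈ M (suc q) s) →
                   Det (suc n) M ≈ 0#
  det-equal-row0 (suc n) M zero    rows≈ = det-equal-rows01 n M rows≈
  det-equal-row0 (suc n) M (suc q) rows≈ = begin
    Det (suc (suc n)) M                         ≈⟨ -‿involutive _ ⟨
    - (- Det (suc (suc n)) M)                   ≈⟨ -‿cong (det-swapRows01 n M) ⟨
    - Det (suc (suc n)) (swapRows01 M)
      ≈⟨ -‿cong (det≈0-if-minors≈0 (suc n) (swapRows01 M) (λ j →
           det-equal-row0 n (minor (swapRows01 M) j) q (rows≈ ∘ punchIn j))) ⟩
    - 0#                                        ≈⟨ -0#≈0# ⟩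
    0#                                          ∎

  det-equal-rows : ∀ n (M : Matrix n) (p q : Fin n) → p ≢ q → (∀ s → M p s ≈ M q s) →
                   Det n M ≈ 0#
  det-equal-rows (suc n) M zero    zero    p≢q _     = ⊥-elim (p≢q ≡.refl)
  det-equal-rows (suc n) M zero    (suc q) _   rows≈ = det-equal-row0 n M q rows≈
  det-equal-rows (suc n) M (suc p) zero    _   rows≈ = det-equal-row0 n M p (sym ∘ rows≈)
  det-equal-rows (suc n) M (suc p) (suc q) p≢q rows≈ = det≈0-if-minors≈0 n M (λ j →
    det-equal-rows n (minor M j) p q (p≢q ∘ ≡.cong suc) (rows≈ ∘ punchIn j))

module DeterminantDivisibility {c ℓ} (R : CommutativeRing c ℓ) where
  open CommutativeRing R hiding (zero)
  open import Algebra.Definitions.RawSemiring (Semiring.rawSemiring semiring) using (_^_)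
  open import Algebra.Definitions.RawMagma *-rawMagma using (_∣ˡ_; _,_)
  open import Algebra.Properties.Magma.Divisibility *-magma using (∣ˡ-respʳ-≈)
  open import Algebra.Properties.Semigroup.Divisibility *-semigroup using (x∣ˡy⇒zx∣ˡzy)
  open import Algebra.Properties.Monoid.Divisibility *-monoid using (ε∣ˡ_)
  open Determinants R using (Matrix; Det; AgreeOffRow; det-linear-row; det-equal-rows)
  open import Relation.Binary.Reasoning.Setoid setoid

  x∣ˡy∧x∣ˡz⇒x∣ˡy+z : ∀ {x y z} → x ∣ˡ y → x ∣ˡ z → x ∣ˡ y + z
  x∣ˡy∧x∣ˡz⇒x∣ˡy+z (p , xp≈y) (q , xq≈z) = p + q , trans (distribˡ _ p q) (+-cong xp≈y xq≈z)

  δ : ∀ {n} → Fin n → Fin n → Carrier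
  δ i s = if does (i ≟ s) then 1# else 0#

  withRow : ∀ {n} → Matrix n → Fin n → (Fin n → Carrier) → Matrix n
  withRow M i v = updateAt M i (const v)

  withRow-agree : ∀ {n} (M : Matrix n) i v → AgreeOffRow i M (withRow M i v)
  withRow-agree M i v r r≢i s = reflexive (≡.sym (≡.cong-app (updateAt-minimal r i M r≢i) s))

  withRow-row : ∀ {n} (M : Matrix n) i v s → withRow M i v i s ≈ v s
  withRow-row M i v s = reflexive (≡.cong-app (updateAt-updates i M) s)

  module _ {n} (x : Carrier) (c : Fin n → Carrier) where

    Row≈xδ+c : Matrix n → Fin n → Set ℓ
    Row≈xδ+c M i = ∀ s → M i s ≈ x * δ i s + c s

    det-split-row : ∀ (M : Matrix n) i → Row≈xδ+c M i →
                    Det n M ≈ x * Det n (withRow M i (δ i)) + Det n (withRow M i c)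
    det-split-row M i row = det-linear-row n i x M _ _ (withRow-agree M i _) (withRow-agree M i _)
      (λ s → trans (row s) (sym (+-cong (*-congˡ (withRow-row M i (δ i) s)) (withRow-row M i c s))))

    withRow-keeps-rows : ∀ {M : Matrix n} {i L} → Unique (i ∷ L) →
      (∀ r → r ∈ₗ i ∷ L → Row≈xδ+c M r) → ∀ v r → r ∈ₗ L → Row≈xδ+c (withRow M i v) r
    withRow-keeps-rows {M} {i} (i∉L ∷ _) rows v r r∈L s =
      trans (sym (withRow-agree M i v r (All-lookup i∉L r∈L ∘ ≡.sym) s)) (rows r (there r∈L) s)

    -- Each term of the expansion of the rows in L that picks c somewhere repeats row u.
    det-divisible-with-row-c : ∀ (L : List (Fin n)) (M : Matrix n) → Unique L →
      (∀ i → i ∈ₗ L → Row≈xδ+c M i) → ∀ u → u ∉ₗ L → (∀ s → M u s ≈ c s) →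
      x ^ length L ∣ˡ Det n M
    det-divisible-with-row-c []      M _ _ _ _ _ = ε∣ˡ Det n M
    det-divisible-with-row-c (i ∷ L) M unique@(_ ∷ unique-L) rows u u∉ row-u≈c =
      ∣ˡ-respʳ-≈ (begin
        x * Det n M₁                 ≈⟨ +-identityʳ _ ⟨
        x * Det n M₁ + 0#            ≈⟨ +-congˡ det-M₂≈0 ⟨
        x * Det n M₁ + Det n M₂      ≈⟨ det-split-row M i (rows i (here ≡.refl)) ⟨
        Det n M                      ∎)
      (x∣ˡy⇒zx∣ˡzy x (det-divisible-with-row-c L M₁ unique-L (withRow-keeps-rows unique rows (δ i))
         u (u∉ ∘ there) (λ s → trans (sym (withRow-agree M i (δ i) u u≢i s)) (row-u≈c s))))
      where
      M₁ = withRow M i (δ i)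
      M₂ = withRow M i c
      u≢i : u ≢ i
      u≢i = u∉ ∘ here
      det-M₂≈0 : Det n M₂ ≈ 0#
      det-M₂≈0 = det-equal-rows n M₂ i u (u≢i ∘ ≡.sym) (λ s →
        trans (withRow-row M i c s) (trans (sym (row-u≈c s)) (withRow-agree M i c u u≢i s)))

    det-divisible : ∀ (L : List (Fin n)) (M : Matrix n) → Unique L →
      (∀ i → i ∈ₗ L → Row≈xδ+c M i) → x ^ (length L ∸ 1) ∣ˡ Det n M
    det-divisible []          M _ _ = ε∣ˡ Det n M
    det-divisible (i ∷ [])    M _ _ = ε∣ˡ Det n M
    det-divisible (i ∷ j ∷ L) M unique@(i∉ ∷ unique-L) rows =
      ∣ˡ-respʳ-≈ (sym (det-split-row M i (rows i (here ≡.refl))))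
        (x∣ˡy∧x∣ˡz⇒x∣ˡy+z
          (x∣ˡy⇒zx∣ˡzy x (det-divisible (j ∷ L) (withRow M i (δ i)) unique-L
                            (withRow-keeps-rows unique rows (δ i))))
          (det-divisible-with-row-c (j ∷ L) (withRow M i c) unique-L
             (withRow-keeps-rows unique rows c) i (λ i∈L → All-lookup i∉ i∈L ≡.refl)
             (withRow-row M i c)))

module PolynomialRing {c ℓ} (R : CommutativeRing c ℓ) where
  open CommutativeRing R hiding (zero)
  open FiniteSums R
  open import Relation.Binary.Reasoning.Setoid setoid

  convolution : ℕ → (ℕ → ℕ → Carrier) → Carrier
  convolution n f = ∑ᵣ {suc n} (λ i → f (toℕ i) (n ∸ toℕ i))

  convolution-cong : ∀ n {f g : ℕ → ℕ → Carrier} → (∀ a b → f a b ≈ g a b) →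
                     convolution n f ≈ convolution n g
  convolution-cong n f≈g = ∑-cong {suc n} (λ i → f≈g (toℕ i) (n ∸ toℕ i))

  convolution-distrib-+ : ∀ n (f g : ℕ → ℕ → Carrier) →
    convolution n (λ a b → f a b + g a b) ≈ convolution n f + convolution n g
  convolution-distrib-+ n f g =
    ∑-distrib-+ {suc n} (λ i → f (toℕ i) (n ∸ toℕ i)) (λ i → g (toℕ i) (n ∸ toℕ i))

  *-distribˡ-convolution : ∀ n x (f : ℕ → ℕ → Carrier) →
    x * convolution n f ≈ convolution n (λ a b → x * f a b)
  *-distribˡ-convolution n x f = *-distribˡ-∑ {suc n} x (λ i → f (toℕ i) (n ∸ toℕ i))

  *-distribʳ-convolution : ∀ n x (f : ℕ → ℕ → Carrier) →
    convolution n f * x ≈ convolution n (λ a b → f a b * x)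
  *-distribʳ-convolution n x f = trans (*-comm _ x)
    (trans (*-distribˡ-convolution n x f) (convolution-cong n (λ a b → *-comm x (f a b))))

  convolution-split-last : ∀ n (f : ℕ → ℕ → Carrier) →
    convolution (suc n) f ≈ convolution n (λ a b → f a (suc b)) + f (suc n) 0
  convolution-split-last zero    f = trans (+-congˡ (+-identityʳ _)) (+-congʳ (sym (+-identityʳ _)))
  convolution-split-last (suc n) f = begin
    f 0 (suc (suc n)) + convolution (suc n) (λ a b → f (suc a) b)
      ≈⟨ +-congˡ (convolution-split-last n (λ a b → f (suc a) b)) ⟩
    f 0 (suc (suc n)) + (convolution n (λ a b → f (suc a) (suc b)) + f (suc (suc n)) 0)
      ≈⟨ +-assoc _ _ _ ⟨
    f 0 (suc (suc n)) + convolution n (λ a b → f (suc a) (suc b)) + f (suc (suc n)) 0 ∎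

  convolution-swap : ∀ n (f : ℕ → ℕ → Carrier) → convolution n f ≈ convolution n (λ a b → f b a)
  convolution-swap zero    f = refl
  convolution-swap (suc n) f = begin
    f 0 (suc n) + convolution n (λ a b → f (suc a) b)
      ≈⟨ +-congˡ (convolution-swap n (λ a b → f (suc a) b)) ⟩
    f 0 (suc n) + convolution n (λ a b → f (suc b) a)  ≈⟨ +-comm _ _ ⟩
    convolution n (λ a b → f (suc b) a) + f 0 (suc n)  ≈⟨ convolution-split-last n (λ a b → f b a) ⟨
    convolution (suc n) (λ a b → f b a)                ∎

  -- Both sides are the sum of g a b c over a + b + c = n.
  convolution-assoc : ∀ n (g : ℕ → ℕ → ℕ → Carrier) →
    convolution n (λ a r → convolution r (g a)) ≈
    convolution n (λ r c → convolution r (λ a b → g a b c))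
  convolution-assoc zero    g = refl
  convolution-assoc (suc n) g = begin
    convolution (suc n) (g 0) + convolution n (λ a r → convolution r (g (suc a)))
      ≈⟨ +-congˡ (convolution-assoc n (g ∘ suc)) ⟩
    (g 0 0 (suc n) + convolution n (λ b c → g 0 (suc b) c)) + convolution n h
      ≈⟨ +-assoc _ _ _ ⟩
    g 0 0 (suc n) + (convolution n (λ b c → g 0 (suc b) c) + convolution n h)
      ≈⟨ +-cong (+-identityʳ _) (convolution-distrib-+ n (λ r c → g 0 (suc r) c) h) ⟨
    (g 0 0 (suc n) + 0#) + convolution n (λ r c → g 0 (suc r) c + h r c)
      ∎
    where
    h : ℕ → ℕ → Carrier
    h r c = convolution r (λ a b → g (suc a) b c)

  open RawRing (polyRawRing R) public using ()
    renaming (_≈_ to _≈ₚ_; _+_ to _+ₚ_; _*_ to _*ₚ_; -_ to -ₚ_; 0# to 0ₚ; 1# to 1ₚ)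

  *ₚ-cong : ∀ {p p′ q q′} → p ≈ₚ p′ → q ≈ₚ q′ → (p *ₚ q) ≈ₚ (p′ *ₚ q′)
  *ₚ-cong p≈p′ q≈q′ n = convolution-cong n (λ a b → *-cong (p≈p′ a) (q≈q′ b))

  *ₚ-comm : ∀ p q → (p *ₚ q) ≈ₚ (q *ₚ p)
  *ₚ-comm p q n =
    trans (convolution-swap n (λ a b → p a * q b)) (convolution-cong n (λ a b → *-comm (p b) (q a)))

  *ₚ-assoc : ∀ p q r → ((p *ₚ q) *ₚ r) ≈ₚ (p *ₚ (q *ₚ r))
  *ₚ-assoc p q r n = begin
    convolution n (λ i k → convolution i (λ a b → p a * q b) * r k)
      ≈⟨ convolution-cong n (λ i k → *-distribʳ-convolution i (r k) (λ a b → p a * q b)) ⟩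
    convolution n (λ i k → convolution i (λ a b → p a * q b * r k))
      ≈⟨ convolution-assoc n (λ a b k → p a * q b * r k) ⟨
    convolution n (λ a j → convolution j (λ b k → p a * q b * r k))
      ≈⟨ convolution-cong n (λ a j → convolution-cong j (λ b k → *-assoc (p a) (q b) (r k))) ⟩
    convolution n (λ a j → convolution j (λ b k → p a * (q b * r k)))
      ≈⟨ convolution-cong n (λ a j → *-distribˡ-convolution j (p a) (λ b k → q b * r k)) ⟨
    convolution n (λ a j → p a * convolution j (λ b k → q b * r k)) ∎

  *ₚ-identityˡ : ∀ p → (1ₚ *ₚ p) ≈ₚ p
  *ₚ-identityˡ p zero    = trans (+-identityʳ _) (*-identityˡ (p 0))
  *ₚ-identityˡ p (suc n) =
    trans (+-cong (*-identityˡ _) (∑-zero {suc n} (λ i → zeroˡ (p (n ∸ toℕ i))))) (+-identityʳ _)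

  *ₚ-identityʳ : ∀ p → (p *ₚ 1ₚ) ≈ₚ p
  *ₚ-identityʳ p n = trans (*ₚ-comm p 1ₚ n) (*ₚ-identityˡ p n)

  *ₚ-distribˡ-+ₚ : ∀ p q r → (p *ₚ (q +ₚ r)) ≈ₚ ((p *ₚ q) +ₚ (p *ₚ r))
  *ₚ-distribˡ-+ₚ p q r n = trans (convolution-cong n (λ a b → distribˡ (p a) (q b) (r b)))
                                 (convolution-distrib-+ n (λ a b → p a * q b) (λ a b → p a * r b))

  *ₚ-distribʳ-+ₚ : ∀ p q r → ((q +ₚ r) *ₚ p) ≈ₚ ((q *ₚ p) +ₚ (r *ₚ p))
  *ₚ-distribʳ-+ₚ p q r n = trans (convolution-cong n (λ a b → distribʳ (p b) (q a) (r a)))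
                                 (convolution-distrib-+ n (λ a b → q a * p b) (λ a b → r a * p b))

  0ₚ-coefficient : ∀ n → 0ₚ n ≈ 0#
  0ₚ-coefficient zero    = refl
  0ₚ-coefficient (suc n) = refl

  +ₚ-isAbelianGroup : IsAbelianGroup _≈ₚ_ _+ₚ_ 0ₚ -ₚ_
  +ₚ-isAbelianGroup = record
    { isGroup = record
      { isMonoid = record
        { isSemigroup = Pointwise.isSemigroup ℕ +-isSemigroup
        ; identity    = (λ p n → trans (+-congʳ (0ₚ-coefficient n)) (+-identityˡ (p n)))
                      , (λ p n → trans (+-congˡ (0ₚ-coefficient n)) (+-identityʳ (p n)))
        }
      ; inverse = (λ p n → trans (-‿inverseˡ (p n)) (sym (0ₚ-coefficient n)))
                , (λ p n → trans (-‿inverseʳ (p n)) (sym (0ₚ-coefficient n)))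
      ; ⁻¹-cong = λ p≈q n → -‿cong (p≈q n)
      }
    ; comm = λ p q n → +-comm (p n) (q n)
    }

  constₚ-cong : ∀ {a b} → a ≈ b → constₚ R a ≈ₚ constₚ R b
  constₚ-cong a≈b zero    = a≈b
  constₚ-cong a≈b (suc n) = refl

  polyCommutativeRing : CommutativeRing c ℓ
  polyCommutativeRing = record
    { isCommutativeRing = record
      { isRing = record
        { +-isAbelianGroup = +ₚ-isAbelianGroup
        ; *-cong           = *ₚ-cong
        ; *-assoc          = *ₚ-assoc
        ; *-identity       = *ₚ-identityˡ , *ₚ-identityʳ
        ; distrib          = *ₚ-distribˡ-+ₚ , *ₚ-distribʳ-+ₚ
        }
      ; *-comm = *ₚ-comm
      }
    }

  open import Algebra.Definitions.RawSemiring (RawRing.rawSemiring (polyRawRing R))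
    public using (_^_)

  ^≡^ₚ : ∀ p r → p ^ r ≡ _^ₚ_ R p r
  ^≡^ₚ p zero    = ≡.refl
  ^≡^ₚ p (suc r) = ≡.cong (p *ₚ_) (^≡^ₚ p r)

elements : ∀ {n} → Subset n → List (Fin n)
elements []           = []
elements (true  ∷ p) = zero ∷ map suc (elements p)
elements (false ∷ p) = map suc (elements p)

length-elements : ∀ {n} (p : Subset n) → length (elements p) ≡ ∣ p ∣
length-elements []          = ≡.refl
length-elements (true  ∷ p) = ≡.cong suc (≡.trans (length-map suc (elements p)) (length-elements p))
length-elements (false ∷ p) = ≡.trans (length-map suc (elements p)) (length-elements p)

elements-unique : ∀ {n} (p : Subset n) → Unique (elements p)
elements-unique []          = []
elements-unique (true  ∷ p) = All.map⁺ (All.universal (λ _ → 0≢1+n) (elements p))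
                              ∷ Unique.map⁺ suc-injective (elements-unique p)
elements-unique (false ∷ p) = Unique.map⁺ suc-injective (elements-unique p)

∈-elements⁻ : ∀ {n} (p : Subset n) i → i ∈ₗ elements p → i ∈ p
∈-elements⁻ (true  ∷ p) zero    _ = here
∈-elements⁻ (true  ∷ p) (suc i) (there i∈) with ∈-map⁻ suc i∈
... | j , j∈ , ≡.refl = there (∈-elements⁻ p j j∈)
∈-elements⁻ (false ∷ p) i       i∈ with ∈-map⁻ suc i∈
... | j , j∈ , ≡.refl = there (∈-elements⁻ p j j∈)

module HyperstarAdjacency {c ℓ} (R : CommutativeRing c ℓ) {N : ℕ} (H : Hypergraph R N)
                          {m k : ℕ} (star : Hyperstar R H m k) where
  open CommutativeRing R hiding (zero)
  open FiniteSums R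
  open Hypergraph H
  open Hyperstar star

  A : Fin N → Fin N → Carrier
  A = adjacency R H

  incidence : Fin N → Fin M → Carrier
  incidence u e = if lookup (edge e) u then w e else 0#

  pair-term≈0 : ∀ e u v → ¬ (u ∈ edge e × v ∈ edge e) →
                (if lookup (edge e) u ∧ lookup (edge e) v then w e else 0#) ≈ 0#
  pair-term≈0 e u v not-both with lookup (edge e) u in u∈e | lookup (edge e) v in v∈e
  ... | true  | true  = ⊥-elim (not-both (lookup⇒[]= u (edge e) u∈e , lookup⇒[]= v (edge e) v∈e))
  ... | true  | false = refl
  ... | false | _     = refl

  star-edge-meets-V₁-once : ∀ {v u e} → v ∈ V₁ → e ∈ₗ P v → u ∈ V₁ → u ∈ edge e → u ≡ v
  star-edge-meets-V₁-once {v} {u} {e} v∈V₁ e∈Pv u∈V₁ u∈e with u ≟ v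
  ... | yes u≡v = u≡v
  ... | no  u≢v = ⊥-elim (disjoint u u∈V₁ (P-sub v v∈V₁ e e∈Pv u u∈e u≢v))

  adjacency-V₁-outside-V₂ : ∀ v s → v ∈ V₁ → s ∉ V₂ → A v s ≈ 0#
  adjacency-V₁-outside-V₂ v s v∈V₁ s∉V₂ with v ≟ s
  ... | yes _   = refl
  ... | no  v≢s = ∑-zero (λ e → pair-term≈0 e v s (not-both e))
    where
    not-both : ∀ e → ¬ (v ∈ edge e × s ∈ edge e)
    not-both e (v∈e , s∈e) = isolated v v∈V₁ s (v≢s ∘ ≡.sym) e not-star-edge (v∈e , s∈e)
      where
      not-star-edge : ¬ ∃ λ v′ → v′ ∈ V₁ × e ∈ₗ P v′
      not-star-edge (v′ , v′∈V₁ , e∈Pv′) with star-edge-meets-V₁-once v′∈V₁ e∈Pv′ v∈V₁ v∈e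
      ... | ≡.refl = s∉V₂ (P-sub v v∈V₁ e e∈Pv′ s s∈e (v≢s ∘ ≡.sym))

  adjacency-V₁-V₂ : ∀ v s → v ∈ V₁ → s ∈ V₂ → A v s ≈ foldr _+_ 0# (map (incidence s) (P v))
  adjacency-V₁-V₂ v s v∈V₁ s∈V₂ with v ≟ s
  ... | yes ≡.refl = ⊥-elim (disjoint v v∈V₁ s∈V₂)
  ... | no  v≢s    = ∑≈foldr (P v) (P-unique v v∈V₁) _ (incidence s) on-Pv off-Pv
    where
    on-Pv : ∀ e → e ∈ₗ P v →
            (if lookup (edge e) v ∧ lookup (edge e) s then w e else 0#) ≈ incidence s e
    on-Pv e e∈Pv rewrite []=⇒lookup (P-contains v v∈V₁ e e∈Pv) = refl
    off-Pv : ∀ e → e ∉ₗ P v → (if lookup (edge e) v ∧ lookup (edge e) s then w e else 0#) ≈ 0#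
    off-Pv e e∉Pv = pair-term≈0 e v s (λ (v∈e , s∈e) →
      isolated v v∈V₁ s (v≢s ∘ ≡.sym) e (not-star-edge v∈e) (v∈e , s∈e))
      where
      not-star-edge : v ∈ edge e → ¬ ∃ λ v′ → v′ ∈ V₁ × e ∈ₗ P v′
      not-star-edge v∈e (v′ , v′∈V₁ , e∈Pv′) with star-edge-meets-V₁-once v′∈V₁ e∈Pv′ v∈V₁ v∈e
      ... | ≡.refl = e∉Pv e∈Pv′

  adjacency-rows-V₁ : ∀ v v′ → v ∈ V₁ → v′ ∈ V₁ → ∀ s → A v s ≈ A v′ s
  adjacency-rows-V₁ v v′ v∈V₁ v′∈V₁ s with s ∈? V₂
  ... | yes s∈V₂ = trans (adjacency-V₁-V₂ v s v∈V₁ s∈V₂)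
                     (trans (balanced s s∈V₂ v v′ v∈V₁ v′∈V₁)
                            (sym (adjacency-V₁-V₂ v′ s v′∈V₁ s∈V₂)))
  ... | no  s∉V₂ = trans (adjacency-V₁-outside-V₂ v s v∈V₁ s∉V₂)
                     (sym (adjacency-V₁-outside-V₂ v′ s v′∈V₁ s∉V₂))

module CharacteristicPolynomial {c ℓ} (R : CommutativeRing c ℓ) {N : ℕ} (H : Hypergraph R N)
                                {m k : ℕ} (star : Hyperstar R H m k) where
  open CommutativeRing R using (Carrier)
  open PolynomialRing R
  open HyperstarAdjacency R H star using (A; adjacency-rows-V₁)
  open Hyperstar star
  module 𝒫 = CommutativeRing polyCommutativeRing
  open Determinants polyCommutativeRing using (Matrix)
  open DeterminantDivisibility polyCommutativeRing using (δ; Row≈xδ+c; det-divisible)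
  open import Algebra.Definitions.RawMagma 𝒫.*-rawMagma using (_∣ˡ_; _,_)
  open import Algebra.Properties.Monoid.Divisibility 𝒫.*-monoid using (ε∣ˡ_)

  charMatrix : Matrix N
  charMatrix i j = (if does (i ≟ j) then Xₚ R else 0ₚ) +ₚ (-ₚ constₚ R (A i j))

  diagonal≈Xδ : ∀ (i j : Fin N) → (if does (i ≟ j) then Xₚ R else 0ₚ) ≈ₚ (Xₚ R *ₚ δ i j)
  diagonal≈Xδ i j with does (i ≟ j)
  ... | true  = 𝒫.sym (𝒫.*-identityʳ (Xₚ R))
  ... | false = 𝒫.sym (𝒫.zeroʳ (Xₚ R))

  charPoly-divisible : ∀ (L : List (Fin N)) → Unique L → (∀ v → v ∈ₗ L → v ∈ V₁) →
                       Xₚ R ^ (length L ∸ 1) ∣ˡ charPoly R N A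
  charPoly-divisible []       _      _     = ε∣ˡ charPoly R N A
  charPoly-divisible (v₀ ∷ L) unique L⊆V₁ =
    det-divisible (Xₚ R) row-v₀ (v₀ ∷ L) charMatrix unique rows
    where
    row-v₀ : Fin N → Poly R
    row-v₀ s = -ₚ constₚ R (A v₀ s)
    rows : ∀ v → v ∈ₗ v₀ ∷ L → Row≈xδ+c (Xₚ R) row-v₀ charMatrix v
    rows v v∈L s = 𝒫.+-cong (diagonal≈Xδ v s) (𝒫.-‿cong (constₚ-cong
      (adjacency-rows-V₁ v v₀ (L⊆V₁ v v∈L) (L⊆V₁ v₀ (here ≡.refl)) s)))

  zeroAlgMult : ∀ (L : List (Fin N)) → Unique L → (∀ v → v ∈ₗ L → v ∈ V₁) →
                ZeroAlgMultAtLeast R N A (length L ∸ 1)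
  zeroAlgMult L unique L⊆V₁ with charPoly-divisible L unique L⊆V₁
  ... | q , X^r*q≈χ = q , ≡.subst (λ X^r → charPoly R N A ≈ₚ (X^r *ₚ q))
                                  (^≡^ₚ (Xₚ R) (length L ∸ 1)) (𝒫.sym X^r*q≈χ)

lemma1 : ∀ {c ℓ ℓ'} (R : CommutativeRing c ℓ)
           (Pos : CommutativeRing.Carrier R → Set ℓ')
           {N : ℕ} (H : Hypergraph R N) →
           (∀ e → Pos (Hypergraph.w H e)) →
           (m k : ℕ) → Hyperstar R H m k → 1 ≤ m →
           ZeroAlgMultAtLeast R N (adjacency R H) (m ∸ 1)
lemma1 R _ {N} H _ m k star _ =
  ≡.subst (λ r → ZeroAlgMultAtLeast R N (adjacency R H) (r ∸ 1))
    (≡.trans (length-elements V₁) card₁)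
    (CharacteristicPolynomial.zeroAlgMult R H star
      (elements V₁) (elements-unique V₁) (∈-elements⁻ V₁))
  where open Hyperstar star
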